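{- Let $N\ge 2$, let $A_1,A_2,\ldots$ be a quasifibonacci sequence of level $N$, let $k\ge1$, and let $n$ be a positive integer with \[n>\sum_{\substack{1\le i\le k-1\\ N\nmid i}}A_{k-i}\] and $S_n\neq\emptyset$. Then $n\ge A_k$.
   Context: For an integer $N\ge 2$, a sequence $A_1,A_2,\ldots$ of positive integers is a quasifibonacci sequence of level $N$ if $A_{k+N}=A_{k+N-1}+\cdots+A_k$ for all $k\ge 1$, and $A_k>A_{k-1}+\cdots+A_1$ for all $1\le k\le N$. Let $\{0,1\}^{\omega}$ be the set of sequences $(a_1,a_2,\ldots)$ with $a_i\in\{0,1\}$ and $a_i=0$ for all but finitely many $i$. For $n\ge0$, $S_n=\{a\in\{0,1\}^{\omega}:\sum_{i}a_iA_i=n\}$. -}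

module Defs where

open import Data.Nat using (ℕ; zero; suc; _+_; _∸_; _≤_; _<_)
open import Data.Nat.Divisibility using (_∣?_)
open import Data.Bool using (Bool; true; false; if_then_else_)
open import Data.Product using (Σ; _×_; ∃)
open import Relation.Nullary using (does)
open import Relation.Binary.PropositionalEquality using (_≡_)

-- Sequences are functions ℕ → _, with the value at index 0 unused
-- (the paper's sequences are indexed from 1).

sumTo : (ℕ → ℕ) → ℕ → ℕ
sumTo f zero    = 0
sumTo f (suc m) = sumTo f m + f (suc m)

record IsQuasifibonacci (N : ℕ) (A : ℕ → ℕ) : Set where
  field
    positive   : ∀ i → 1 ≤ i → 1 ≤ A i
    recurrence : ∀ k → 1 ≤ k → A (k + N) ≡ sumTo (λ j → A (k ∸ 1 + j)) N
    initial    : ∀ k → 1 ≤ k → k ≤ N → sumTo A (k ∸ 1) < A k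

bitval : Bool → ℕ → ℕ
bitval b x = if b then x else 0

-- a ∈ {0,1}^ω (a : ℕ → Bool, index 0 unused, finitely many true)
-- lies in S_n : Σ_i a_i A_i = n.  The finite support is witnessed by a
-- bound M beyond which a vanishes; the sum is then over 1..M.
InS : (A : ℕ → ℕ) (n : ℕ) (a : ℕ → Bool) → Set
InS A n a = Σ ℕ λ M → (∀ i → M < i → a i ≡ false)
                    × sumTo (λ i → bitval (a i) (A i)) M ≡ n

SNonempty : (A : ℕ → ℕ) (n : ℕ) → Set
SNonempty A n = ∃ λ (a : ℕ → Bool) → InS A n a

restrictedSum : (N : ℕ) (A : ℕ → ℕ) (k : ℕ) → ℕ
restrictedSum N A k = sumTo (λ i → if does (N ∣? i) then 0 else A (k ∸ i)) (k ∸ 1)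

module Submission where

-- Notation: F m = A_1 + ⋯ + A_m, G k = Σ_{1≤i<k, N∤i} A_{k-i} (restrictedSum), and for a
-- 0/1-selection a, S_a m = Σ_{i≤m} a_i A_i.  The heart of the proof is the estimate
--
--   (★)  for k ≥ 1 and every selection a:   S_a (k-1) < A_k  ⇒  S_a (k-1) ≤ G k,
--
-- It is proved by
-- induction in strides of N.  For k ≤ N nothing is excluded from G k, so G k = F (k-1).
-- For k = K + N the indices below k split into 1..K and the window K+1, …, K+N-1, and
--   A_{K+N} = A_K + (window sum),      G (K+N) = G K + (window sum).
-- Starting from (★) at K, the window terms are added one at a time: a selected term
-- shifts both bounds, while an omitted term is covered by the prefix estimate
-- F K ≤ A_{K+1} + G K, itself proved by stride induction.  The corollary follows: if a
-- subset sum n is below A_k, enlarging the range of indices changes nothing (A is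
-- nondecreasing and the selection has finite support), so (★) gives n ≤ G k < n.

open import Defs
open import Data.Nat using (ℕ; zero; suc; _+_; _∸_; _≤_; _<_; _≥_; _≤′_; ≤′-refl; ≤′-step; z≤n; s≤s; z<s; _<?_)
open import Data.Nat.Properties
open import Data.Nat.Divisibility using (_∣_; _∣?_; >⇒∤; ∣-refl; ∣m+n∣m⇒∣n; ∣m∣n⇒∣m+n)
open import Data.Nat.Induction using (<-rec)
open import Data.Nat.Tactic.RingSolver using (solve-∀)
open import Data.Bool using (Bool; true; false; if_then_else_)
open import Data.Product using (_,_)
open import Level using (Level)
open import Relation.Nullary using (does; yes; no; ¬_)
open import Relation.Nullary.Decidable using (dec-true; dec-false)
open import Relation.Nullary.Negation using (contradiction)
open import Relation.Binary.PropositionalEquality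
  using (_≡_; refl; sym; trans; cong; cong₂; subst; subst₂; module ≡-Reasoning)

window : (ℕ → ℕ) → ℕ → ℕ → ℕ
window A K t = sumTo (λ j → A (K + j)) t

sumTo-cong : ∀ {f g : ℕ → ℕ} n → (∀ i → 1 ≤ i → i ≤ n → f i ≡ g i) → sumTo f n ≡ sumTo g n
sumTo-cong zero    _  = refl
sumTo-cong (suc n) f≡g =
  cong₂ _+_ (sumTo-cong n (λ i 1≤i i≤n → f≡g i 1≤i (m≤n⇒m≤1+n i≤n))) (f≡g (suc n) (s≤s z≤n) ≤-refl)

sumTo-mono : ∀ {f g : ℕ → ℕ} n → (∀ i → f i ≤ g i) → sumTo f n ≤ sumTo g n
sumTo-mono zero    _   = z≤n
sumTo-mono (suc n) f≤g = +-mono-≤ (sumTo-mono n f≤g) (f≤g (suc n))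

sumTo-split : ∀ (f : ℕ → ℕ) m n → sumTo f (m + n) ≡ sumTo f m + window f m n
sumTo-split f m zero    = trans (cong (sumTo f) (+-identityʳ m)) (sym (+-identityʳ _))
sumTo-split f m (suc n) = begin
  sumTo f (m + suc n)                         ≡⟨ cong (sumTo f) (+-suc m n) ⟩
  sumTo f (m + n) + f (suc (m + n))           ≡⟨ cong (_+ f (suc (m + n))) (sumTo-split f m n) ⟩
  sumTo f m + window f m n + f (suc (m + n))  ≡⟨ +-assoc (sumTo f m) _ _ ⟩
  sumTo f m + (window f m n + f (suc (m + n))) ≡⟨ cong (λ x → sumTo f m + (window f m n + f x)) (sym (+-suc m n)) ⟩
  sumTo f m + window f m (suc n)              ∎
  where open ≡-Reasoning

sumTo-front : ∀ (f : ℕ → ℕ) n → sumTo f (suc n) ≡ f 1 + sumTo (λ i → f (suc i)) n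
sumTo-front f zero    = +-comm 0 (f 1)
sumTo-front f (suc n) = trans (cong (_+ f (suc (suc n))) (sumTo-front f n)) (+-assoc (f 1) _ _)

sumTo-reverse : ∀ (f : ℕ → ℕ) n → sumTo f n ≡ sumTo (λ i → f (suc n ∸ i)) n
sumTo-reverse f zero    = refl
sumTo-reverse f (suc n) = begin
  sumTo f n + f (suc n)                               ≡⟨ cong (_+ f (suc n)) (sumTo-reverse f n) ⟩
  sumTo (λ i → f (suc n ∸ i)) n + f (suc n)           ≡⟨ +-comm _ (f (suc n)) ⟩
  f (suc n) + sumTo (λ i → f (suc n ∸ i)) n           ≡⟨ sym (sumTo-front (λ i → f (suc (suc n) ∸ i)) n) ⟩
  sumTo (λ i → f (suc (suc n) ∸ i)) (suc n)           ∎
  where open ≡-Reasoning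

data StrideView (d : ℕ) : ℕ → Set where
  below : ∀ {k} → k < d → StrideView d k
  above : ∀ j → StrideView d (j + d)

stride-view : ∀ d k → StrideView d k
stride-view d k with k <? d
... | yes k<d = below k<d
... | no  k≮d = subst (StrideView d) (m∸n+n≡m (≮⇒≥ k≮d)) (above (k ∸ d))

stride-induction : ∀ {ℓ : Level} s (P : ℕ → Set ℓ) →
  (∀ k → k < suc s → P k) → (∀ j → P j → P (j + suc s)) → ∀ k → P k
stride-induction s P base step = <-rec P go
  where
    go : ∀ k → (∀ {j} → j < k → P j) → P k
    go k rec with stride-view (suc s) k
    ... | below k<d = base k k<d
    ... | above j   = step j (rec (m<m+n j z<s))

module RestrictedSum (P : ℕ) (A : ℕ → ℕ) where

  N : ℕ
  N = suc P

  term : ℕ → ℕ → ℕ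
  term k i = if does (N ∣? i) then 0 else A (k ∸ i)

  term-div : ∀ k {i} → N ∣ i → term k i ≡ 0
  term-div k {i} N∣i rewrite dec-true (N ∣? i) N∣i = refl

  term-nondiv : ∀ k {i} → ¬ N ∣ i → term k i ≡ A (k ∸ i)
  term-nondiv k {i} N∤i rewrite dec-false (N ∣? i) N∤i = refl

  short-nondiv : ∀ i → 1 ≤ i → i < N → ¬ N ∣ i
  short-nondiv (suc i) _ i<N = >⇒∤ i<N

  term-shift : ∀ K i → term (K + N) (N + i) ≡ term K i
  term-shift K i with N ∣? i
  ... | yes N∣i = trans (term-div (K + N) (∣m∣n⇒∣m+n ∣-refl N∣i)) (sym (term-div K N∣i))
  ... | no  N∤i = begin
    term (K + N) (N + i)  ≡⟨ term-nondiv (K + N) (λ N∣N+i → N∤i (∣m+n∣m⇒∣n N∣N+i ∣-refl)) ⟩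
    A (K + N ∸ (N + i))   ≡⟨ cong (λ x → A (x ∸ (N + i))) (+-comm K N) ⟩
    A (N + K ∸ (N + i))   ≡⟨ cong A ([m+n]∸[m+o]≡n∸o N K i) ⟩
    A (K ∸ i)             ≡⟨ sym (term-nondiv K N∤i) ⟩
    term K i              ∎
    where open ≡-Reasoning

  restrictedSum-short : ∀ k → suc k ≤ N → restrictedSum N A (suc k) ≡ sumTo A k
  restrictedSum-short k k<N = begin
    sumTo (term (suc k)) k              ≡⟨ sumTo-cong k (λ i 1≤i i≤k →
                                             term-nondiv (suc k) (short-nondiv i 1≤i (≤-<-trans i≤k k<N))) ⟩
    sumTo (λ i → A (suc k ∸ i)) k       ≡⟨ sym (sumTo-reverse A k) ⟩
    sumTo A k                           ∎
    where open ≡-Reasoning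

  leading-terms : ∀ K → sumTo (term (K + N)) P ≡ window A K P
  leading-terms K = begin
    sumTo (term (K + N)) P                      ≡⟨ sumTo-cong P (λ i 1≤i i≤P →
                                                     term-nondiv (K + N) (short-nondiv i 1≤i (s≤s i≤P))) ⟩
    sumTo (λ i → A (K + N ∸ i)) P               ≡⟨ sumTo-reverse _ P ⟩
    sumTo (λ i → A (K + N ∸ (N ∸ i))) P         ≡⟨ sumTo-cong P (λ i _ i≤P → cong A (index i (m≤n⇒m≤1+n i≤P))) ⟩
    window A K P                                ∎
    where
      open ≡-Reasoning
      index : ∀ i → i ≤ N → K + N ∸ (N ∸ i) ≡ K + i
      index i i≤N = trans (+-∸-assoc K (m∸n≤m N i)) (cong (K +_) (m∸[m∸n]≡n i≤N))

  restrictedSum-step : ∀ K → restrictedSum N A (suc K + N) ≡ restrictedSum N A (suc K) + window A (suc K) P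
  restrictedSum-step K = begin
    sumTo (term k) (K + N)                                     ≡⟨ cong (sumTo (term k)) (+-comm K N) ⟩
    sumTo (term k) (N + K)                                     ≡⟨ sumTo-split (term k) N K ⟩
    sumTo (term k) P + term k N + window (term k) N K          ≡⟨ cong₂ (λ x y → sumTo (term k) P + x + y)
                                                                    (term-div k ∣-refl)
                                                                    (sumTo-cong K (λ i _ _ → term-shift (suc K) i)) ⟩
    sumTo (term k) P + 0 + restrictedSum N A (suc K)           ≡⟨ cong (_+ restrictedSum N A (suc K))
                                                                    (trans (+-identityʳ _) (leading-terms (suc K))) ⟩
    window A (suc K) P + restrictedSum N A (suc K)             ≡⟨ +-comm (window A (suc K) P) _ ⟩
    restrictedSum N A (suc K) + window A (suc K) P             ∎
    where
      open ≡-Reasoning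
      k = suc K + N

module SubsetSums (A : ℕ → ℕ) where

  subsetSum : (ℕ → Bool) → ℕ → ℕ
  subsetSum a m = sumTo (λ i → bitval (a i) (A i)) m

  SubsetBound : ℕ → ℕ → ℕ → Set
  SubsetBound m B D = ∀ a → subsetSum a m < B → subsetSum a m ≤ D

  bitval≤ : ∀ b x → bitval b x ≤ x
  bitval≤ true  x = ≤-refl
  bitval≤ false x = z≤n

  subsetSum≤prefix : ∀ a m → subsetSum a m ≤ sumTo A m
  subsetSum≤prefix a m = sumTo-mono m (λ i → bitval≤ (a i) (A i))

  subsetSum-stable : ∀ {M m} a → (∀ i → M < i → a i ≡ false) → M ≤′ m → subsetSum a m ≡ subsetSum a M
  subsetSum-stable a vanish ≤′-refl = refl
  subsetSum-stable {M} {suc m} a vanish (≤′-step M≤m)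
    rewrite vanish (suc m) (s≤s (≤′⇒≤ M≤m)) = trans (+-identityʳ _) (subsetSum-stable a vanish M≤m)

  bound-cong : ∀ {m m′ B B′ D D′} → m ≡ m′ → B ≡ B′ → D ≡ D′ → SubsetBound m B D → SubsetBound m′ B′ D′
  bound-cong refl refl refl bound = bound

  bound-trivial : ∀ m B → SubsetBound m B (sumTo A m)
  bound-trivial m B a _ = subsetSum≤prefix a m

  bound-skip : ∀ {m B D} → SubsetBound m B D → B ≤ A (suc m) → SubsetBound (suc m) B D
  bound-skip {m} bound B≤A a lt with a (suc m)
  ... | true  = contradiction (≤-trans B≤A (m≤n+m _ _)) (<⇒≱ lt)
  ... | false = subst (_≤ _) (sym (+-identityʳ _)) (bound a (subst (_< _) (+-identityʳ _) lt))

  bound-skip-all : ∀ {m m′ B D} → SubsetBound m B D → (∀ i → m < i → B ≤ A i) → m ≤′ m′ → SubsetBound m′ B D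
  bound-skip-all bound large ≤′-refl = bound
  bound-skip-all bound large (≤′-step m≤m′) =
    bound-skip (bound-skip-all bound large m≤m′) (large _ (s≤s (≤′⇒≤ m≤m′)))

  -- Adding the term A_{m+1} to both bounds is sound provided omitting it is harmless,
  -- i.e. provided F m ≤ D + A_{m+1}.
  bound-add : ∀ {m B D} → SubsetBound m B D → sumTo A m ≤ D + A (suc m) →
              SubsetBound (suc m) (B + A (suc m)) (D + A (suc m))
  bound-add {m} bound gap a lt with a (suc m)
  ... | true  = +-monoˡ-≤ (A (suc m)) (bound a (+-cancelʳ-< (A (suc m)) _ _ lt))
  ... | false = subst (_≤ _) (sym (+-identityʳ _)) (≤-trans (subsetSum≤prefix a m) gap)

  bound-window : ∀ {m B D} → SubsetBound m B D →
    (∀ t → sumTo A (m + t) ≤ (D + window A m t) + A (suc (m + t))) →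
    ∀ t → SubsetBound (m + t) (B + window A m t) (D + window A m t)
  bound-window {m} bound gap zero =
    bound-cong (sym (+-identityʳ m)) (sym (+-identityʳ _)) (sym (+-identityʳ _)) bound
  bound-window {m} {B} {D} bound gap (suc t) =
    bound-cong (sym (+-suc m t)) (shift B) (shift D) (bound-add (bound-window bound gap t) (gap t))
    where
      shift : ∀ X → X + window A m t + A (suc (m + t)) ≡ X + window A m (suc t)
      shift X = trans (+-assoc X _ _) (cong (λ x → X + (window A m t + A x)) (sym (+-suc m t)))

module Quasifibonacci (P′ : ℕ) {A : ℕ → ℕ} (qf : IsQuasifibonacci (suc (suc P′)) A) where
  open IsQuasifibonacci qf
  open SubsetSums A public

  P N : ℕ
  P = suc P′
  N = suc P

  open RestrictedSum P A using (restrictedSum-short; restrictedSum-step)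

  G : ℕ → ℕ
  G = restrictedSum N A

  A-window : ∀ K → A (suc K + N) ≡ A (suc K) + window A (suc K) P
  A-window K = begin
    A (suc K + N)                                 ≡⟨ recurrence (suc K) (s≤s z≤n) ⟩
    sumTo (λ j → A (K + j)) N                     ≡⟨ sumTo-front (λ j → A (K + j)) P ⟩
    A (K + 1) + sumTo (λ j → A (K + suc j)) P     ≡⟨ cong₂ _+_ (cong A (+-comm K 1))
                                                       (sumTo-cong P (λ j _ _ → cong A (+-suc K j))) ⟩
    A (suc K) + window A (suc K) P                ∎
    where open ≡-Reasoning

  prefix-step : ∀ K → sumTo A (K + N) ≡ sumTo A K + A (suc (K + N))
  prefix-step K = trans (sumTo-split A K N) (cong (sumTo A K +_) (sym (recurrence (suc K) (s≤s z≤n))))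

  -- A is nondecreasing: below N by the initial condition, beyond it because
  -- A_{j+N} is the last summand of A_{j+N+1}.
  A-step : ∀ i → 1 ≤ i → A i ≤ A (suc i)
  A-step i 1≤i with stride-view N i
  ... | below i<N = ≤-trans (term≤prefix 1≤i) (<⇒≤ (initial (suc i) (s≤s z≤n) i<N))
    where
      term≤prefix : ∀ {i} → 1 ≤ i → A i ≤ sumTo A i
      term≤prefix {suc i} _ = m≤n+m (A (suc i)) (sumTo A i)
  ... | above j   =
    subst (A (j + N) ≤_) (sym (recurrence (suc j) (s≤s z≤n))) (m≤n+m (A (j + N)) _)

  A-mono : ∀ {i j} → 1 ≤ i → i ≤ j → A i ≤ A j
  A-mono {i} 1≤i i≤j = go (≤⇒≤′ i≤j)
    where
      go : ∀ {j} → i ≤′ j → A i ≤ A j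
      go ≤′-refl            = ≤-refl
      go (≤′-step i≤j)      = ≤-trans (go i≤j) (A-step _ (≤-trans 1≤i (≤′⇒≤ i≤j)))

  A≤window : ∀ K → A (suc K) ≤ window A K P
  A≤window K = subst₂ _≤_ (cong A (+-comm K 1)) (sym (sumTo-front (λ j → A (K + j)) P′)) (m≤m+n _ _)

  prefix-bound : ∀ q → sumTo A q ≤ A (suc q) + G q
  prefix-bound = stride-induction P (λ q → sumTo A q ≤ A (suc q) + G q) base step
    where
      open ≤-Reasoning
      base : ∀ q → q < N → sumTo A q ≤ A (suc q) + G q
      base q q<N = ≤-trans (<⇒≤ (initial (suc q) (s≤s z≤n) q<N)) (m≤m+n _ _)
      prefix≤G : ∀ K → sumTo A K ≤ A (suc K) + G K → sumTo A K ≤ G (K + N)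
      prefix≤G zero    _      = z≤n
      prefix≤G (suc K) bound-K = begin
        sumTo A (suc K)                        ≤⟨ bound-K ⟩
        A (suc (suc K)) + G (suc K)            ≤⟨ +-monoˡ-≤ (G (suc K)) (A≤window (suc K)) ⟩
        window A (suc K) P + G (suc K)         ≡⟨ +-comm (window A (suc K) P) _ ⟩
        G (suc K) + window A (suc K) P         ≡⟨ sym (restrictedSum-step K) ⟩
        G (suc K + N)                          ∎
      step : ∀ K → sumTo A K ≤ A (suc K) + G K → sumTo A (K + N) ≤ A (suc (K + N)) + G (K + N)
      step K bound-K = begin
        sumTo A (K + N)                        ≡⟨ prefix-step K ⟩
        sumTo A K + A (suc (K + N))            ≤⟨ +-monoˡ-≤ _ (prefix≤G K bound-K) ⟩
        G (K + N) + A (suc (K + N))            ≡⟨ +-comm (G (K + N)) _ ⟩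
        A (suc (K + N)) + G (K + N)            ∎

  window-gap : ∀ K t → sumTo A (suc K + t) ≤ (G (suc K) + window A (suc K) t) + A (suc (suc K + t))
  window-gap K t = begin
    sumTo A (suc K + t)                                         ≡⟨ sumTo-split A (suc K) t ⟩
    sumTo A (suc K) + window A (suc K) t                        ≤⟨ +-monoˡ-≤ _ (prefix-bound (suc K)) ⟩
    A (suc (suc K)) + G (suc K) + window A (suc K) t            ≤⟨ +-monoˡ-≤ _ (+-monoˡ-≤ _
                                                                     (A-mono (s≤s z≤n) (s≤s (s≤s (m≤m+n K t))))) ⟩
    A (suc (suc K + t)) + G (suc K) + window A (suc K) t        ≡⟨ rearrange (A (suc (suc K + t))) (G (suc K)) _ ⟩
    G (suc K) + window A (suc K) t + A (suc (suc K + t))        ∎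
    where
      open ≤-Reasoning
      rearrange : ∀ a g w → a + g + w ≡ g + w + a
      rearrange = solve-∀

  restricted-bound : ∀ k → SubsetBound k (A (suc k)) (G (suc k))
  restricted-bound = stride-induction P (λ k → SubsetBound k (A (suc k)) (G (suc k))) base step
    where
      base : ∀ k → k < N → SubsetBound k (A (suc k)) (G (suc k))
      base k k<N = subst (SubsetBound k (A (suc k))) (sym (restrictedSum-short k k<N)) (bound-trivial k _)
      -- From (★) at K = j+1, skip A_K itself, then add the window A_{K+1}, …, A_{K+P}.
      step : ∀ j → SubsetBound j (A (suc j)) (G (suc j)) → SubsetBound (j + N) (A (suc (j + N))) (G (suc (j + N)))
      step j bound-j = bound-cong (sym (+-suc j P)) (sym (A-window j)) (sym (restrictedSum-step j))
        (bound-window (bound-skip bound-j ≤-refl) (window-gap j) P)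

corollary3p2 : (N : ℕ) → 2 ≤ N → (A : ℕ → ℕ) → IsQuasifibonacci N A →
    (k : ℕ) → 1 ≤ k → (n : ℕ) → 1 ≤ n → restrictedSum N A k < n →
    SNonempty A n → n ≥ A k
corollary3p2 zero          ()      _ _  _       _ _ _ _   _
corollary3p2 (suc zero)    (s≤s ()) _ _ _       _ _ _ _   _
corollary3p2 (suc (suc P′)) _      A qf zero    () _ _ _  _
corollary3p2 (suc (suc P′)) _      A qf (suc k) _ n _ G<n (a , M , vanish , sum≡n) =
  ≮⇒≥ (λ n<A → <⇒≱ G<n (n≤G n<A))
  where
    open Quasifibonacci P′ qf
    -- Summing up to M + k covers both the support of a and all indices ≤ k.
    m : ℕ
    m = M + k
    sum-m≡n : subsetSum a m ≡ n
    sum-m≡n = trans (subsetSum-stable a vanish (≤⇒≤′ (m≤m+n M k))) sum≡n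
    bound-m : SubsetBound m (A (suc k)) (G (suc k))
    bound-m = bound-skip-all (restricted-bound k) (λ i k<i → A-mono (s≤s z≤n) k<i) (≤⇒≤′ (m≤n+m k M))
    n≤G : n < A (suc k) → n ≤ G (suc k)
    n≤G n<A = subst (_≤ G (suc k)) sum-m≡n (bound-m a (subst (_< A (suc k)) (sym sum-m≡n) n<A))
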